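{- Let $k\ge1$ and let $N_1,\ldots,N_k\in\mathbb{Z}$ be pairwise coprime nonzero integers; put $f_i=x-N_i$ and $\mathcal{R}=\{0,1,\ldots,|N_1\cdots N_k|-1\}$. Then the simultaneous digit system defined by the $f_i$ and $\mathcal{R}$ has the Finite Expansion Property if and only if $N_i\le-2$ for all $i$ and either $k=1$, or $k=2$ and $|N_1-N_2|=1$.
   Context: The simultaneous digit system here is $(V,\phi,N)$ with $V=\mathbb{Z}^k$ (identified with $\prod_i\mathbb{Z}[x]/(x-N_i)$), $\phi(a_1,\ldots,a_k)=(N_1a_1,\ldots,N_ka_k)$, and digit set $N=\{(c,\ldots,c)\mid c\in\mathcal{R}\}$. It has the Finite Expansion Property if every $v\in V$ equals $\sum_{i=0}^\ell\phi^i(d_i)$ with $d_i\in N$. -}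

module Defs where

open import Data.Nat as ℕ using (ℕ; zero; suc)
open import Data.Integer as ℤ using (ℤ; +_; _+_; _*_; _^_)
open import Data.Fin using (Fin)
open import Data.List using (List; []; _∷_)
open import Data.List.Relation.Unary.All using (All)
open import Data.Product using (Σ; _×_)
open import Relation.Binary.PropositionalEquality using (_≡_)

-- V = ℤ^k, elements as functions Fin k → ℤ (component i lives in ℤ[x]/(x - N_i) ≅ ℤ).

prodFin : ∀ {k} → (Fin k → ℤ) → ℤ
prodFin {zero} N = ℤ.1ℤ
prodFin {suc k} N = N Fin.zero * prodFin (λ i → N (Fin.suc i))
  where import Data.Fin as Fin

digitBound : ∀ {k} → (Fin k → ℤ) → ℕ
digitBound N = ℤ.∣ prodFin N ∣

-- Evaluation of an expansion with digit values c_0, c_1, …, c_ℓ (each c_i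
-- giving the digit (c_i,…,c_i) ∈ 𝒩) in a single coordinate with base n:
--   Σ_i n^i * c_i   (this is the coordinate of Σ_i φ^i(d_i))
evalDigits : ℤ → List ℕ → ℤ
evalDigits n [] = + 0
evalDigits n (c ∷ cs) = + c + n * evalDigits n cs

expansion : ∀ {k} → (Fin k → ℤ) → List ℕ → (Fin k → ℤ)
expansion N cs j = evalDigits (N j) cs

-- Finite Expansion Property of the simultaneous digit system (V, φ, 𝒩)
-- with φ(a_1,…,a_k) = (N_1 a_1, …, N_k a_k) and 𝒩 = {(c,…,c) | c ∈ ℛ},
-- ℛ = {0,…,|N_1⋯N_k| - 1}.
FiniteExpansionProperty : ∀ {k} → (Fin k → ℤ) → Set
FiniteExpansionProperty {k} N =
  (v : Fin k → ℤ) →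
  Σ (List ℕ) λ cs → All (λ c → c ℕ.< digitBound N) cs × ((j : Fin k) → v j ≡ expansion N cs j)

{-# OPTIONS --safe #-}

-- Necessity: expanding the unit vector eᵢ gives evalDigits Nᵢ cs - evalDigits Nⱼ cs = 1, a
-- multiple of Nᵢ - Nⱼ, so the Nᵢ are pairwise adjacent integers and k ≤ 2.  Expanding
-- (-1,…,-1) forbids Nᵢ ≥ 0.  Nᵢ = -1 would make the digit bound 1 or |Nⱼ|; but digits below
-- |Nⱼ| expanding 0 in base Nⱼ all vanish, so eᵢ would have no expansion.
-- Sufficiency: for k = 1 this is the negative base -M with digits 0,…,M-1, where division
-- by -M shrinks |a| until |a| ≤ 1.  For the bases -M and -(M+1) the digit of (a, b) is
-- determined modulo M(M+1), and one division step shrinks max(|a|, |b|) until it is at most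
-- M + 3.  Four more steps land in [-1, M+1] × [0, M-1], where the sign of (M+1)a - Mb and its
-- size relative to M(M+1) give an explicit expansion with at most four more digits.

module Submission where

open import Defs
open import Data.Nat as ℕ using (ℕ; suc)
open import Data.Integer as ℤ using (ℤ; _-_; -[1+_]; _≤_)
open import Data.Nat.Coprimality using (Coprime)
open import Data.Fin using (Fin)
open import Data.Product using (Σ; _×_)
open import Data.Sum using (_⊎_)
open import Relation.Binary.PropositionalEquality using (_≡_; _≢_)
open import Function.Bundles using (_⇔_)

open import Data.Nat using (zero; z≤n; s≤s; s≤s⁻¹)
import Data.Nat.Properties as ℕ
import Data.Nat.Divisibility as ℕ using (∣1⇒≡1)
open import Data.Integer using (+_; _+_; _*_; -_; _<_; 0ℤ; 1ℤ; -1ℤ; ∣_∣; nonNegative; +≤+; +<+; -≤-; -≤+; -<+)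
open import Data.Integer.Properties hiding (_≟_)
open import Data.Integer.Divisibility.Signed using (_∣_; divides; ∣-refl; ∣m∣n⇒∣m+n; ∣m⇒∣m*n; ∣n⇒∣m*n; ∣⇒∣ᵤ)
open import Data.Integer.Tactic.RingSolver using (solve-∀)
import Data.Nat.Tactic.RingSolver as ℕ-Solver
open import Data.Integer.DivMod using (_%ℕ_; _/ℕ_; a≡a%ℕn+[a/ℕn]*n; n%ℕd<d)
open import Data.Fin using (zero; suc; _≟_)
open import Data.List using (List; []; _∷_)
open import Data.List.Relation.Unary.All using (All; []; _∷_)
open import Data.Product using (_,_; ∃)
open import Data.Sum using (inj₁; inj₂)
open import Data.Empty using (⊥-elim)
open import Relation.Nullary using (¬_; yes; no)
open import Relation.Binary.PropositionalEquality
  using (refl; sym; trans; cong; cong₂; subst; module ≡-Reasoning)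
open import Function.Bundles using (mk⇔)

∣i∣≡1⇒i≡±1 : ∀ {i} → ∣ i ∣ ≡ 1 → i ≡ 1ℤ ⊎ i ≡ -1ℤ
∣i∣≡1⇒i≡±1 {+ 1}      _ = inj₁ refl
∣i∣≡1⇒i≡±1 { -[1+ 0 ]} _ = inj₂ refl

∣i+j∣≢1 : ∀ i j → ∣ i ∣ ≡ 1 → ∣ j ∣ ≡ 1 → ∣ i + j ∣ ≢ 1
∣i+j∣≢1 i j ∣i∣≡1 ∣j∣≡1 with ∣i∣≡1⇒i≡±1 {i} ∣i∣≡1 | ∣i∣≡1⇒i≡±1 {j} ∣j∣≡1
... | inj₁ refl | inj₁ refl = λ ()
... | inj₁ refl | inj₂ refl = λ ()
... | inj₂ refl | inj₁ refl = λ ()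
... | inj₂ refl | inj₂ refl = λ ()

no-three-adjacent : ∀ x y z → ∣ x - y ∣ ≡ 1 → ∣ y - z ∣ ≡ 1 → ∣ x - z ∣ ≢ 1
no-three-adjacent x y z xy yz =
  subst (λ e → ∣ e ∣ ≢ 1) (sym (split x y z)) (∣i+j∣≢1 (x - y) (y - z) xy yz)
  where
  split : ∀ x y z → x - z ≡ (x - y) + (y - z)
  split = solve-∀

∣i-j∣≡1⇒adjacent : ∀ {i j} → ∣ i - j ∣ ≡ 1 → j ≡ i - 1ℤ ⊎ i ≡ j - 1ℤ
∣i-j∣≡1⇒adjacent {i} {j} h with ∣i∣≡1⇒i≡±1 {i - j} h
... | inj₁ i-j≡1  = inj₁ (trans (sym (cancel i j)) (cong (λ e → i - e) i-j≡1))
  where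
  cancel : ∀ i j → i - (i - j) ≡ j
  cancel = solve-∀
... | inj₂ i-j≡-1 = inj₂ (trans (sym (cancel i j)) (cong (λ e → j + e) i-j≡-1))
  where
  cancel : ∀ i j → j + (i - j) ≡ i
  cancel = solve-∀

≤-2⇒≡-[2+n] : ∀ {i} → i ≤ -[1+ 1 ] → ∃ λ n → i ≡ -[1+ suc n ]
≤-2⇒≡-[2+n] { -[1+ suc n ]} _ = n , refl
≤-2⇒≡-[2+n] { -[1+ zero ]} (-≤- ())

<0∧≢-1⇒≤-2 : ∀ {i} → i < 0ℤ → i ≢ -1ℤ → i ≤ -[1+ 1 ]
<0∧≢-1⇒≤-2 { -[1+ zero ]}  _ i≢-1 = ⊥-elim (i≢-1 refl)
<0∧≢-1⇒≤-2 { -[1+ suc n ]} _ _    = -≤- (s≤s z≤n)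
<0∧≢-1⇒≤-2 {+ n}          (+<+ ())

0≤i*j : ∀ {i j} → 0ℤ ≤ i → 0ℤ ≤ j → 0ℤ ≤ i * j
0≤i*j {+ i} {+ j} _ _ = subst (0ℤ ≤_) (pos-* i j) (+≤+ z≤n)

i<suc[j]⇒i≤j : ∀ {i j} → i < ℤ.suc j → i ≤ j
i<suc[j]⇒i≤j {i} {j} i<1+j = subst (i ≤_) (pred-suc j) (i<j⇒i≤pred[j] i<1+j)

-[1+K]<x⇒-K≤x : ∀ {K x} → -[1+ K ] < x → - + K ≤ x
-[1+K]<x⇒-K≤x {zero}  = i<j⇒suc[i]≤j
-[1+K]<x⇒-K≤x {suc K} = i<j⇒suc[i]≤j

i+j≡0⇒i≡-j : ∀ i j → i + j ≡ 0ℤ → i ≡ - j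
i+j≡0⇒i≡-j i j i+j≡0 = trans (i≡[i+j]-j i j) (trans (cong (_- j) i+j≡0) (+-identityˡ (- j)))
  where
  i≡[i+j]-j : ∀ i j → i ≡ (i + j) - j
  i≡[i+j]-j = solve-∀

≤-by-offset : ∀ {p q} e → q ≡ p ℕ.+ e → p ℕ.≤ q
≤-by-offset {p} e refl = ℕ.m≤m+n p e

n*k<n⇒k≡0 : ∀ n k → n ℕ.* k ℕ.< n → k ≡ 0
n*k<n⇒k≡0 n zero    _  = refl
n*k<n⇒k≡0 n (suc k) nk<n = ⊥-elim (ℕ.<⇒≱ nk<n (ℕ.m≤m*n n (suc k)))

_∈[-_,_] : ℤ → ℕ → ℕ → Set
x ∈[- K , U ] = - + K ≤ x × x ≤ + U

∣x∣≤K⇒x∈[-K,K] : ∀ {x K} → ∣ x ∣ ℕ.≤ K → x ∈[- K , K ]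
∣x∣≤K⇒x∈[-K,K] {+ n}      n≤K       = ≤-trans (neg-mono-≤ (+≤+ z≤n)) (+≤+ z≤n) , +≤+ n≤K
∣x∣≤K⇒x∈[-K,K] { -[1+ n ]} (s≤s n<K) = neg-mono-≤ (+≤+ (s≤s n<K)) , -≤+

evalDigits-nonNeg : ∀ {x} cs → 0ℤ ≤ x → 0ℤ ≤ evalDigits x cs
evalDigits-nonNeg []       _   = +≤+ z≤n
evalDigits-nonNeg (c ∷ cs) 0≤x = +-mono-≤ (+≤+ z≤n) (0≤i*j 0≤x (evalDigits-nonNeg cs 0≤x))

evalDigits-zeros : ∀ x cs → All (_≡ 0) cs → evalDigits x cs ≡ 0ℤ
evalDigits-zeros x []       []          = refl
evalDigits-zeros x (c ∷ cs) (refl ∷ zs) =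
  trans (cong (λ e → + 0 + x * e) (evalDigits-zeros x cs zs))
        (trans (+-identityˡ (x * 0ℤ)) (*-zeroʳ x))

digits<1⇒zeros : ∀ cs → All (ℕ._< 1) cs → All (_≡ 0) cs
digits<1⇒zeros []       []              = []
digits<1⇒zeros (0 ∷ cs) (s≤s z≤n ∷ ds) = refl ∷ digits<1⇒zeros cs ds

evalDigits≡0⇒zeros : ∀ x cs → All (ℕ._< ∣ x ∣) cs → evalDigits x cs ≡ 0ℤ → All (_≡ 0) cs
evalDigits≡0⇒zeros x []       []           _  = []
evalDigits≡0⇒zeros x (c ∷ cs) (c<∣x∣ ∷ ds) eq = c≡0 ∷ evalDigits≡0⇒zeros x cs ds tail≡0
  where
  tail : ℤ
  tail = evalDigits x cs
  c≡∣x∣*∣tail∣ : c ≡ ∣ x ∣ ℕ.* ∣ tail ∣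
  c≡∣x∣*∣tail∣ = begin
    c                  ≡⟨ cong ∣_∣ (i+j≡0⇒i≡-j (+ c) (x * tail) eq) ⟩
    ∣ - (x * tail) ∣    ≡⟨ ∣-i∣≡∣i∣ (x * tail) ⟩
    ∣ x * tail ∣        ≡⟨ abs-* x tail ⟩
    ∣ x ∣ ℕ.* ∣ tail ∣  ∎
    where open ≡-Reasoning
  ∣tail∣≡0 : ∣ tail ∣ ≡ 0
  ∣tail∣≡0 = n*k<n⇒k≡0 ∣ x ∣ ∣ tail ∣ (subst (ℕ._< ∣ x ∣) c≡∣x∣*∣tail∣ c<∣x∣)
  tail≡0 : tail ≡ 0ℤ
  tail≡0 = ∣i∣≡0⇒i≡0 ∣tail∣≡0
  c≡0 : c ≡ 0
  c≡0 = trans c≡∣x∣*∣tail∣ (trans (cong (∣ x ∣ ℕ.*_) ∣tail∣≡0) (ℕ.*-zeroʳ ∣ x ∣))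

evalDigits-sub-∣ : ∀ x y cs → (x - y) ∣ (evalDigits x cs - evalDigits y cs)
evalDigits-sub-∣ x y []       = divides 0ℤ refl
evalDigits-sub-∣ x y (c ∷ cs) =
  subst ((x - y) ∣_) (sym (split (+ c) x y (evalDigits x cs) (evalDigits y cs)))
    (∣m∣n⇒∣m+n (∣m⇒∣m*n (evalDigits x cs) ∣-refl) (∣n⇒∣m*n y (evalDigits-sub-∣ x y cs)))
  where
  split : ∀ c x y X Y → (c + x * X) - (c + y * Y) ≡ (x - y) * X + y * (X - Y)
  split = solve-∀

digitBound-single : (N : Fin 1 → ℤ) → digitBound N ≡ ∣ N zero ∣
digitBound-single N = cong ∣_∣ (*-identityʳ (N zero))

digitBound-pair : (N : Fin 2 → ℤ) → digitBound N ≡ ∣ N zero ∣ ℕ.* ∣ N (suc zero) ∣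
digitBound-pair N =
  trans (abs-* (N zero) _) (cong (λ e → ∣ N zero ∣ ℕ.* ∣ e ∣) (*-identityʳ (N (suc zero))))

digitStep-abs< : ∀ {p x x′ : ℤ} {r C : ℕ} → r ℕ.< C → x ≡ + r + p * x′ →
                 ∣ p ∣ ℕ.* ∣ x′ ∣ ℕ.< C ℕ.+ ∣ x ∣
digitStep-abs< {p} {x} {x′} {r} {C} r<C x≡ = begin-strict
  ∣ p ∣ ℕ.* ∣ x′ ∣  ≡⟨ abs-* p x′ ⟨
  ∣ p * x′ ∣        ≡⟨ cong ∣_∣ (trans (y≡[r+y]-r (+ r) (p * x′)) (cong (_- + r) (sym x≡))) ⟩
  ∣ x - + r ∣       ≤⟨ ∣i-j∣≤∣i∣+∣j∣ x (+ r) ⟩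
  ∣ x ∣ ℕ.+ r       <⟨ ℕ.+-monoʳ-< ∣ x ∣ r<C ⟩
  ∣ x ∣ ℕ.+ C       ≡⟨ ℕ.+-comm ∣ x ∣ C ⟩
  C ℕ.+ ∣ x ∣       ∎
  where
  open ℕ.≤-Reasoning
  y≡[r+y]-r : ∀ r y → y ≡ (r + y) - r
  y≡[r+y]-r = solve-∀

quotient-shrinks : ∀ {n C T A A′} → C ℕ.≤ n ℕ.* suc T → suc n ℕ.* A′ ℕ.< C ℕ.+ A →
                   A′ ℕ.≤ T ⊎ A′ ℕ.< A
quotient-shrinks {n} {C} {T} {A} {A′} C≤n[1+T] nA′<C+A with A′ ℕ.≤? T
... | yes A′≤T = inj₁ A′≤T
... | no  A′≰T = inj₂ (ℕ.+-cancelˡ-< C A′ A (begin-strict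
  C ℕ.+ A′           ≤⟨ ℕ.+-monoˡ-≤ A′ (ℕ.≤-trans C≤n[1+T] (ℕ.*-monoʳ-≤ n (ℕ.≰⇒> A′≰T))) ⟩
  n ℕ.* A′ ℕ.+ A′    ≡⟨ ℕ.+-comm (n ℕ.* A′) A′ ⟩
  suc n ℕ.* A′       <⟨ nA′<C+A ⟩
  C ℕ.+ A            ∎))
  where open ℕ.≤-Reasoning

digitStep-∈ : ∀ {n r C K U K′ U′ : ℕ} {x x′ : ℤ} → r ℕ.< C → x ≡ + r + (- + n) * x′ →
              x ∈[- K , U ] → U ℕ.< n ℕ.* suc K′ → C ℕ.+ K ℕ.≤ n ℕ.* suc U′ →
              x′ ∈[- K′ , U′ ]
digitStep-∈ {n} {r} {C} {K} {U} {K′} {U′} {x} {x′} r<C x≡ (-K≤x , x≤U) U<n[1+K′] C+K≤n[1+U′] =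
  -[1+K]<x⇒-K≤x (*-cancelˡ-<-nonNeg (+ n) lower) , i<j⇒i≤pred[j] (*-cancelˡ-<-nonNeg (+ n) upper)
  where
  open ≤-Reasoning
  nx′≡r-x : + n * x′ ≡ + r - x
  nx′≡r-x = trans (quotient (+ n) (+ r) x′) (cong (λ y → + r - y) (sym x≡))
    where
    quotient : ∀ n r y → n * y ≡ r - (r + (- n) * y)
    quotient = solve-∀
  lower : + n * -[1+ K′ ] < + n * x′
  lower = begin-strict
    + n * -[1+ K′ ]      ≡⟨ neg-distribʳ-* (+ n) (+ suc K′) ⟨
    - (+ n * + suc K′)   ≡⟨ cong -_ (pos-* n (suc K′)) ⟨
    - + (n ℕ.* suc K′)   <⟨ neg-mono-< (+<+ U<n[1+K′]) ⟩
    - + U                ≤⟨ neg-mono-≤ x≤U ⟩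
    - x                  ≤⟨ i≤j+i (- x) (+ r) ⟩
    + r - x              ≡⟨ nx′≡r-x ⟨
    + n * x′             ∎
  upper : + n * x′ < + n * + suc U′
  upper = begin-strict
    + n * x′             ≡⟨ nx′≡r-x ⟩
    + r - x              ≤⟨ +-monoʳ-≤ (+ r) (≤-trans (neg-mono-≤ -K≤x) (≤-reflexive (neg-involutive (+ K)))) ⟩
    + r + + K            <⟨ +<+ (ℕ.+-monoˡ-< K r<C) ⟩
    + (C ℕ.+ K)          ≤⟨ +≤+ C+K≤n[1+U′] ⟩
    + (n ℕ.* suc U′)     ≡⟨ pos-* n (suc U′) ⟩
    + n * + suc U′       ∎

unitVector : ∀ {k} → Fin k → Fin k → ℤ
unitVector i j with j ≟ i
... | yes _ = 1ℤ
... | no  _ = 0ℤ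

unitVector-diag : ∀ {k} (i : Fin k) → unitVector i i ≡ 1ℤ
unitVector-diag i with i ≟ i
... | yes _   = refl
... | no  i≢i = ⊥-elim (i≢i refl)

unitVector-offDiag : ∀ {k} {i j : Fin k} → i ≢ j → unitVector i j ≡ 0ℤ
unitVector-offDiag {i = i} {j} i≢j with j ≟ i
... | yes j≡i = ⊥-elim (i≢j (sym j≡i))
... | no  _   = refl

module _ {k} (N : Fin k → ℤ) (fep : FiniteExpansionProperty N) where

  fep⇒adjacent : ∀ {i j} → i ≢ j → ∣ N i - N j ∣ ≡ 1
  fep⇒adjacent {i} {j} i≢j with fep (unitVector i)
  ... | cs , _ , eq =
    ℕ.∣1⇒≡1 (∣⇒∣ᵤ (subst ((N i - N j) ∣_) e₁-e₂≡1 (evalDigits-sub-∣ (N i) (N j) cs)))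
    where
    e₁-e₂≡1 : evalDigits (N i) cs - evalDigits (N j) cs ≡ 1ℤ
    e₁-e₂≡1 = trans (cong₂ _-_ (sym (eq i)) (sym (eq j)))
                    (cong₂ _-_ (unitVector-diag i) (unitVector-offDiag i≢j))

  fep⇒negative : ∀ i → N i < 0ℤ
  fep⇒negative i with fep (λ _ → -1ℤ)
  ... | cs , _ , eq = ≰⇒> λ 0≤Nᵢ → 0≰-1 (subst (0ℤ ≤_) (sym (eq i)) (evalDigits-nonNeg cs 0≤Nᵢ))
    where
    0≰-1 : ¬ (0ℤ ≤ -1ℤ)
    0≰-1 ()

  fep⇒digitBound≢∣Nⱼ∣ : ∀ {i j} → i ≢ j → digitBound N ≢ ∣ N j ∣
  fep⇒digitBound≢∣Nⱼ∣ {i} {j} i≢j B≡∣Nⱼ∣ with fep (unitVector i)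
  ... | cs , ds , eq = 1≢0 (begin
      1ℤ                    ≡⟨ unitVector-diag i ⟨
      unitVector i i        ≡⟨ eq i ⟩
      evalDigits (N i) cs   ≡⟨ evalDigits-zeros (N i) cs zeros ⟩
      0ℤ                    ∎)
    where
    open ≡-Reasoning
    zeros : All (_≡ 0) cs
    zeros = evalDigits≡0⇒zeros (N j) cs (subst (λ B → All (ℕ._< B) cs) B≡∣Nⱼ∣ ds)
                               (trans (sym (eq j)) (unitVector-offDiag i≢j))
    1≢0 : 1ℤ ≢ 0ℤ
    1≢0 ()

  fep⇒digitBound≢1 : Fin k → digitBound N ≢ 1
  fep⇒digitBound≢1 i B≡1 with fep (λ _ → 1ℤ)
  ... | cs , ds , eq = 1≢0 (trans (eq i) (evalDigits-zeros (N i) cs zeros))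
    where
    zeros : All (_≡ 0) cs
    zeros = digits<1⇒zeros cs (subst (λ B → All (ℕ._< B) cs) B≡1 ds)
    1≢0 : 1ℤ ≢ 0ℤ
    1≢0 ()

single-fep⇒≤-2 : (N : Fin 1 → ℤ) → FiniteExpansionProperty N → ∀ i → N i ≤ -[1+ 1 ]
single-fep⇒≤-2 N fep zero = <0∧≢-1⇒≤-2 (fep⇒negative N fep zero) λ N₀≡-1 →
  fep⇒digitBound≢1 N fep zero (trans (digitBound-single N) (cong ∣_∣ N₀≡-1))

pair-fep⇒≤-2 : (N : Fin 2 → ℤ) → FiniteExpansionProperty N → ∀ i → N i ≤ -[1+ 1 ]
pair-fep⇒≤-2 N fep i = <0∧≢-1⇒≤-2 (fep⇒negative N fep i) (Nᵢ≢-1 i)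
  where
  Nᵢ≢-1 : ∀ i → N i ≢ -1ℤ
  Nᵢ≢-1 zero N₀≡-1 = fep⇒digitBound≢∣Nⱼ∣ N fep {zero} {suc zero} (λ ())
    (trans (digitBound-pair N) (trans (cong (λ x → ∣ x ∣ ℕ.* ∣ N (suc zero) ∣) N₀≡-1) (ℕ.*-identityˡ _)))
  Nᵢ≢-1 (suc zero) N₁≡-1 = fep⇒digitBound≢∣Nⱼ∣ N fep {suc zero} {zero} (λ ())
    (trans (digitBound-pair N) (trans (cong (λ x → ∣ N zero ∣ ℕ.* ∣ x ∣) N₁≡-1) (ℕ.*-identityʳ _)))

Expansion : ℕ → ℤ → ℤ → Set
Expansion B p a = Σ (List ℕ) λ cs → All (ℕ._< B) cs × a ≡ evalDigits p cs

JointExpansion : ℕ → ℤ → ℤ → ℤ → ℤ → Set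
JointExpansion B p q a b =
  Σ (List ℕ) λ cs → All (ℕ._< B) cs × a ≡ evalDigits p cs × b ≡ evalDigits q cs

expansion-∷ : ∀ {B p a a′} c → c ℕ.< B → a ≡ + c + p * a′ → Expansion B p a′ → Expansion B p a
expansion-∷ {p = p} c c<B eq (cs , ds , eq′) =
  c ∷ cs , c<B ∷ ds , trans eq (cong (λ e → + c + p * e) eq′)

jointExpansion-∷ : ∀ {B p q a b a′ b′} c → c ℕ.< B → a ≡ + c + p * a′ → b ≡ + c + q * b′ →
                   JointExpansion B p q a′ b′ → JointExpansion B p q a b
jointExpansion-∷ {p = p} {q} c c<B eqa eqb (cs , ds , eqa′ , eqb′) =
  c ∷ cs , c<B ∷ ds , trans eqa (cong (λ e → + c + p * e) eqa′)
                    , trans eqb (cong (λ e → + c + q * e) eqb′)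

jointExpansion-swap : ∀ {B p q a b} → JointExpansion B p q a b → JointExpansion B q p b a
jointExpansion-swap (cs , ds , eqa , eqb) = cs , ds , eqb , eqa

fep-single : ∀ (N : Fin 1 → ℤ) {B p} → N zero ≡ p → ∣ p ∣ ≡ B → (∀ a → Expansion B p a) →
             FiniteExpansionProperty N
fep-single N refl refl expand v with expand (v zero)
... | cs , ds , eq = cs , subst (λ B → All (ℕ._< B) cs) (sym (digitBound-single N)) ds , λ { zero → eq }

fep-pair : ∀ (N : Fin 2 → ℤ) {B p q} → N zero ≡ p → N (suc zero) ≡ q → ∣ p ∣ ℕ.* ∣ q ∣ ≡ B →
           (∀ a b → JointExpansion B p q a b) → FiniteExpansionProperty N
fep-pair N refl refl refl expand v with expand (v zero) (v (suc zero))
... | cs , ds , eqa , eqb =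
  cs , subst (λ B → All (ℕ._< B) cs) (sym (digitBound-pair N)) ds , λ { zero → eqa ; (suc zero) → eqb }

module NegativeBase (m : ℕ) where

  B : ℕ
  B = 2 ℕ.+ m

  P : ℤ
  P = - + B

  expansion-one : Expansion B P 1ℤ
  expansion-one = expansion-∷ 1 (s≤s (s≤s z≤n)) (1≡1+p*0 P) ([] , [] , refl)
    where
    1≡1+p*0 : ∀ p → 1ℤ ≡ 1ℤ + p * 0ℤ
    1≡1+p*0 = solve-∀

  expansion-small : ∀ a → ∣ a ∣ ℕ.≤ 1 → Expansion B P a
  expansion-small (+ 0)           _        = [] , [] , refl
  expansion-small (+ 1)           _        = expansion-one
  expansion-small -[1+ 0 ]        _        = expansion-∷ (suc m) ℕ.≤-refl (-1≡ (+ B)) expansion-one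
    where
    -1≡ : ∀ b → -1ℤ ≡ (b - 1ℤ) + (- b) * 1ℤ
    -1≡ = solve-∀
  expansion-small (+ suc (suc _)) (s≤s ())
  expansion-small -[1+ suc _ ]    (s≤s ())

  B≤[1+m]*2 : B ℕ.≤ suc m ℕ.* 2
  B≤[1+m]*2 = s≤s (s≤s (ℕ.m≤m*n m 2))

  expansion-below : ∀ n {a} → ∣ a ∣ ℕ.< n → Expansion B P a
  expansion-below (suc n) {a} ∣a∣≤n with ∣ a ∣ ℕ.≤? 1
  ... | yes ∣a∣≤1 = expansion-small a ∣a∣≤1
  ... | no  ∣a∣≰1 =
    expansion-∷ {a′ = a′} r r<B a≡r+P*a′ (expansion-below n (ℕ.<-≤-trans ∣a′∣<∣a∣ (s≤s⁻¹ ∣a∣≤n)))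
    where
    r : ℕ
    r = a %ℕ B
    r<B : r ℕ.< B
    r<B = n%ℕd<d a B
    a′ : ℤ
    a′ = - (a /ℕ B)
    a≡r+P*a′ : a ≡ + r + P * a′
    a≡r+P*a′ = trans (a≡a%ℕn+[a/ℕn]*n a B) (cong (λ e → + r + e) (q*b≡[-b]*[-q] (a /ℕ B) (+ B)))
      where
      q*b≡[-b]*[-q] : ∀ q b → q * b ≡ (- b) * (- q)
      q*b≡[-b]*[-q] = solve-∀
    ∣a′∣<∣a∣ : ∣ a′ ∣ ℕ.< ∣ a ∣
    ∣a′∣<∣a∣ with quotient-shrinks {suc m} {T = 1} B≤[1+m]*2 (digitStep-abs< {P} {x′ = a′} r<B a≡r+P*a′)
    ... | inj₁ ∣a′∣≤1 = ℕ.≤-<-trans ∣a′∣≤1 (ℕ.≰⇒> ∣a∣≰1)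
    ... | inj₂ ∣a′∣<∣a∣ = ∣a′∣<∣a∣

  negativeBase-expansion : ∀ a → Expansion B P a
  negativeBase-expansion a = expansion-below (suc ∣ a ∣) ℕ.≤-refl

module AdjacentBases (m : ℕ) where

  Mₙ Cₙ T : ℕ
  Mₙ = 2 ℕ.+ m
  Cₙ = Mₙ ℕ.* (Mₙ ℕ.+ 1)
  -- The least bound with Cₙ ≤ (Mₙ - 1) * (T + 1) when Mₙ = 2, as quotient-shrinks needs.
  T  = Mₙ ℕ.+ 3

  M P Q C : ℤ
  M = + Mₙ
  P = - M
  Q = - (M + 1ℤ)
  C = M * (M + 1ℤ)

  Rep : ℤ → ℤ → Set
  Rep = JointExpansion Cₙ P Q

  P-1≡Q : ∀ {x} → x ≡ P → x - 1ℤ ≡ Q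
  P-1≡Q x≡P = trans (cong (_- 1ℤ) x≡P) (sym (neg-distrib-+ M 1ℤ))

  Mₙ+1<Cₙ : Mₙ ℕ.+ 1 ℕ.< Cₙ
  Mₙ+1<Cₙ = ≤-by-offset (m ℕ.* m ℕ.+ 4 ℕ.* m ℕ.+ 2) (eq m)
    where
    eq : ∀ m → (2 ℕ.+ m) ℕ.* ((2 ℕ.+ m) ℕ.+ 1) ≡ suc ((2 ℕ.+ m) ℕ.+ 1) ℕ.+ (m ℕ.* m ℕ.+ 4 ℕ.* m ℕ.+ 2)
    eq = ℕ-Solver.solve-∀

  Mₙ+[Mₙ+1]≤Cₙ : Mₙ ℕ.+ (Mₙ ℕ.+ 1) ℕ.* 1 ℕ.≤ Cₙ
  Mₙ+[Mₙ+1]≤Cₙ = ≤-by-offset (m ℕ.* m ℕ.+ 3 ℕ.* m ℕ.+ 1) (eq m)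
    where
    eq : ∀ m → (2 ℕ.+ m) ℕ.* ((2 ℕ.+ m) ℕ.+ 1) ≡
               ((2 ℕ.+ m) ℕ.+ ((2 ℕ.+ m) ℕ.+ 1) ℕ.* 1) ℕ.+ (m ℕ.* m ℕ.+ 3 ℕ.* m ℕ.+ 1)
    eq = ℕ-Solver.solve-∀

  Mₙ-1+[Mₙ+1]²<2Cₙ : suc m ℕ.+ (Mₙ ℕ.+ 1) ℕ.* (Mₙ ℕ.+ 1) ℕ.< Cₙ ℕ.+ Cₙ
  Mₙ-1+[Mₙ+1]²<2Cₙ = ≤-by-offset (m ℕ.* m ℕ.+ 3 ℕ.* m ℕ.+ 1) (eq m)
    where
    eq : ∀ m → (2 ℕ.+ m) ℕ.* ((2 ℕ.+ m) ℕ.+ 1) ℕ.+ (2 ℕ.+ m) ℕ.* ((2 ℕ.+ m) ℕ.+ 1) ≡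
               suc (suc m ℕ.+ ((2 ℕ.+ m) ℕ.+ 1) ℕ.* ((2 ℕ.+ m) ℕ.+ 1)) ℕ.+ (m ℕ.* m ℕ.+ 3 ℕ.* m ℕ.+ 1)
    eq = ℕ-Solver.solve-∀

  rep-step : ∀ {a b a′ b′} c → 0ℤ ≤ c → c < C → a ≡ c + P * a′ → b ≡ c + Q * b′ →
             Rep a′ b′ → Rep a b
  rep-step c 0≤c c<C a≡ b≡ =
    jointExpansion-∷ ∣ c ∣ (drop‿+<+ (subst (_< C) (sym +∣c∣≡c) c<C))
      (subst (λ e → _ ≡ e + P * _) (sym +∣c∣≡c) a≡) (subst (λ e → _ ≡ e + Q * _) (sym +∣c∣≡c) b≡)
    where
    +∣c∣≡c : + ∣ c ∣ ≡ c
    +∣c∣≡c = 0≤i⇒+∣i∣≡i 0≤c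

  record Step (a b : ℤ) : Set where
    field
      digit   : ℕ
      digit<C : digit ℕ.< Cₙ
      a′ b′   : ℤ
      a≡      : a ≡ + digit + P * a′
      b≡      : b ≡ + digit + Q * b′

    rep : Rep a′ b′ → Rep a b
    rep = jointExpansion-∷ digit digit<C a≡ b≡

  -- (M + 1) a - M b ≡ a (mod M) and ≡ b (mod M + 1), so its residue mod C is the only possible digit.
  divisionStep : ∀ a b → Step a b
  divisionStep a b = record
    { digit = s %ℕ Cₙ ; digit<C = n%ℕd<d s Cₙ ; a′ = d - (M + 1ℤ) * t ; b′ = d - M * t
    ; a≡ = trans (a≡ M a b t) (cong (λ e → e + P * (d - (M + 1ℤ) * t)) r≡s-tC)
    ; b≡ = trans (b≡ M a b t) (cong (λ e → e + Q * (d - M * t)) r≡s-tC) }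
    where
    s d t : ℤ
    s = (M + 1ℤ) * a - M * b
    d = a - b
    t = s /ℕ Cₙ
    r≡s-tC : s - t * C ≡ + (s %ℕ Cₙ)
    r≡s-tC = trans (cong (_- t * C) (a≡a%ℕn+[a/ℕn]*n s Cₙ)) (r+x-x≡r (+ (s %ℕ Cₙ)) (t * C))
      where
      r+x-x≡r : ∀ r x → (r + x) - x ≡ r
      r+x-x≡r = solve-∀
    a≡ : ∀ M a b t → a ≡ ((M + 1ℤ) * a - M * b - t * (M * (M + 1ℤ))) + (- M) * ((a - b) - (M + 1ℤ) * t)
    a≡ = solve-∀
    b≡ : ∀ M a b t → b ≡ ((M + 1ℤ) * a - M * b - t * (M * (M + 1ℤ))) + (- (M + 1ℤ)) * ((a - b) - M * t)
    b≡ = solve-∀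

  -- In the final phase a point is written (b + d, b); then s b d = (M + 1) a - M b.
  s : ℤ → ℤ → ℤ
  s b d = b + (M + 1ℤ) * d

  s<[M+1]x⇒d<x : ∀ {b d x} → 0ℤ ≤ b → s b d < (M + 1ℤ) * x → d < x
  s<[M+1]x⇒d<x {b} {d} 0≤b s<[M+1]x =
    *-cancelˡ-<-nonNeg (M + 1ℤ) (≤-<-trans (i≤j+i ((M + 1ℤ) * d) b ⦃ nonNegative 0≤b ⦄) s<[M+1]x)

  [M+1]x≤s⇒x≤d : ∀ {b d x} → b ≤ M - 1ℤ → (M + 1ℤ) * x ≤ s b d → x ≤ d
  [M+1]x≤s⇒x≤d {b} {d} {x} b≤M-1 [M+1]x≤s =
    i<suc[j]⇒i≤j (*-cancelˡ-<-nonNeg (M + 1ℤ) (≤-<-trans [M+1]x≤s (begin-strict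
      b + (M + 1ℤ) * d              ≤⟨ +-monoˡ-≤ ((M + 1ℤ) * d) b≤M-1 ⟩
      (M - 1ℤ) + (M + 1ℤ) * d       <⟨ +-monoˡ-< ((M + 1ℤ) * d) (+<+ (s≤s (s≤s (ℕ.m≤m+n m 1)))) ⟩
      (M + 1ℤ) + (M + 1ℤ) * d       ≡⟨ *-suc (M + 1ℤ) d ⟨
      (M + 1ℤ) * ℤ.suc d            ∎)))
    where open ≤-Reasoning

  rep-diagonal : ∀ {x} → 0ℤ ≤ x → x < C → Rep x x
  rep-diagonal {x} 0≤x x<C = rep-step x 0≤x x<C (x≡x+p*0 x P) (x≡x+p*0 x Q) ([] , [] , refl , refl)
    where
    x≡x+p*0 : ∀ x p → x ≡ x + p * 0ℤ
    x≡x+p*0 = solve-∀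

  rep-two-digits : ∀ {b d} → 0ℤ ≤ s b d → s b d < C → 0ℤ ≤ d → d < C → Rep (b + d) b
  rep-two-digits {b} {d} 0≤s s<C 0≤d d<C =
    rep-step (s b d) 0≤s s<C (a≡ M b d) (b≡ M b d) (rep-diagonal 0≤d d<C)
    where
    a≡ : ∀ M b d → b + d ≡ (b + (M + 1ℤ) * d) + (- M) * d
    a≡ = solve-∀
    b≡ : ∀ M b d → b ≡ (b + (M + 1ℤ) * d) + (- (M + 1ℤ)) * d
    b≡ = solve-∀

  rep-s<0 : ∀ {b d} → 0ℤ ≤ b → - M ≤ d → s b d < 0ℤ → Rep (b + d) b
  rep-s<0 {b} {d} 0≤b -M≤d s<0 =
    rep-step (s b d + C) 0≤s+C s+C<C (a≡ M b d) (b≡ M b d)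
      (rep-two-digits 0≤s′ s′<C (+≤+ z≤n) (+<+ (s≤s (s≤s z≤n))))
    where
    open ≤-Reasoning
    a≡ : ∀ M b d → b + d ≡ ((b + (M + 1ℤ) * d) + M * (M + 1ℤ)) + (- M) * ((d + M) + 1ℤ)
    a≡ = solve-∀
    b≡ : ∀ M b d → b ≡ ((b + (M + 1ℤ) * d) + M * (M + 1ℤ)) + (- (M + 1ℤ)) * (d + M)
    b≡ = solve-∀
    s+C≡ : ∀ M b d → b + (M + 1ℤ) * (d + M) ≡ (b + (M + 1ℤ) * d) + M * (M + 1ℤ)
    s+C≡ = solve-∀
    0≤d+M : 0ℤ ≤ d + M
    0≤d+M = subst (_≤ d + M) (+-inverseˡ M) (+-monoˡ-≤ M -M≤d)
    0≤s+C : 0ℤ ≤ s b d + C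
    0≤s+C = subst (0ℤ ≤_) (s+C≡ M b d) (+-mono-≤ 0≤b (0≤i*j {M + 1ℤ} (+≤+ z≤n) 0≤d+M))
    s+C<C : s b d + C < C
    s+C<C = subst (s b d + C <_) (+-identityˡ C) (+-monoˡ-< C s<0)
    0≤s′ : 0ℤ ≤ s (d + M) 1ℤ
    0≤s′ = +-mono-≤ 0≤d+M (+≤+ z≤n)
    s′<C : s (d + M) 1ℤ < C
    s′<C = begin-strict
      (d + M) + (M + 1ℤ) * 1ℤ      <⟨ +-monoˡ-< ((M + 1ℤ) * 1ℤ) (+-monoˡ-< M d<0) ⟩
      (0ℤ + M) + (M + 1ℤ) * 1ℤ     ≤⟨ +≤+ Mₙ+[Mₙ+1]≤Cₙ ⟩
      C                            ∎
      where
      d<0 : d < 0ℤ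
      d<0 = s<[M+1]x⇒d<x 0≤b (subst (s b d <_) (sym (*-zeroʳ (M + 1ℤ))) s<0)

  rep-C≤s : ∀ {b d} → b ≤ M - 1ℤ → d ≤ M + 1ℤ → C ≤ s b d → Rep (b + d) b
  rep-C≤s {b} {d} b≤M-1 d≤M+1 C≤s =
    rep-step (s b d - C) (i≤j⇒0≤j-i C≤s) s-C<C (a≡ M b d) (b≡ M b d) (rep-s<0 0≤d-M (-≤- z≤n) s′<0)
    where
    open ≤-Reasoning
    a≡ : ∀ M b d → b + d ≡ ((b + (M + 1ℤ) * d) - M * (M + 1ℤ)) + (- M) * ((d - M) + -1ℤ)
    a≡ = solve-∀
    b≡ : ∀ M b d → b ≡ ((b + (M + 1ℤ) * d) - M * (M + 1ℤ)) + (- (M + 1ℤ)) * (d - M)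
    b≡ = solve-∀
    0≤d-M : 0ℤ ≤ d - M
    0≤d-M = i≤j⇒0≤j-i ([M+1]x≤s⇒x≤d b≤M-1 (subst (_≤ s b d) (*-comm M (M + 1ℤ)) C≤s))
    s<C+C : s b d < C + C
    s<C+C = begin-strict
      s b d                             ≤⟨ +-mono-≤ b≤M-1 (*-monoˡ-≤-nonNeg (M + 1ℤ) d≤M+1) ⟩
      (M - 1ℤ) + (M + 1ℤ) * (M + 1ℤ)    <⟨ +<+ Mₙ-1+[Mₙ+1]²<2Cₙ ⟩
      C + C                             ∎
    s-C<C : s b d - C < C
    s-C<C = subst (s b d - C <_) ([x+y]-y≡x C C) (+-monoˡ-< (- C) s<C+C)
      where
      [x+y]-y≡x : ∀ x y → (x + y) - y ≡ x
      [x+y]-y≡x = solve-∀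
    s′<0 : s (d - M) -1ℤ < 0ℤ
    s′<0 = begin-strict
      (d - M) + (M + 1ℤ) * -1ℤ             ≤⟨ +-monoˡ-≤ ((M + 1ℤ) * -1ℤ) (+-monoˡ-≤ (- M) d≤M+1) ⟩
      ((M + 1ℤ) - M) + (M + 1ℤ) * -1ℤ      ≡⟨ s′≡ M ⟩
      - M                                  <⟨ -<+ ⟩
      0ℤ                                   ∎
      where
      s′≡ : ∀ M → ((M + 1ℤ) - M) + (M + 1ℤ) * -1ℤ ≡ - M
      s′≡ = solve-∀

  rep-final : ∀ {b d} → 0ℤ ≤ b → b ≤ M - 1ℤ → - M ≤ d → d ≤ M + 1ℤ → Rep (b + d) b
  rep-final {b} {d} 0≤b b≤M-1 -M≤d d≤M+1 with s b d <? 0ℤ | s b d <? C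
  ... | yes s<0 | _       = rep-s<0 0≤b -M≤d s<0
  ... | no  s≮0 | no  s≮C = rep-C≤s b≤M-1 d≤M+1 (≮⇒≥ s≮C)
  ... | no  s≮0 | yes s<C = rep-two-digits (≮⇒≥ s≮0) s<C 0≤d (≤-<-trans d≤M+1 (+<+ Mₙ+1<Cₙ))
    where
    0≤d : 0ℤ ≤ d
    0≤d = [M+1]x≤s⇒x≤d b≤M-1 (subst (_≤ s b d) (sym (*-zeroʳ (M + 1ℤ))) (≮⇒≥ s≮0))

  RepOnBox : ℕ → ℕ → ℕ → ℕ → Set
  RepOnBox Kᵃ Uᵃ Kᵇ Uᵇ = ∀ {a b} → a ∈[- Kᵃ , Uᵃ ] → b ∈[- Kᵇ , Uᵇ ] → Rep a b

  repOnBox-final : RepOnBox 1 (Mₙ ℕ.+ 1) 0 (suc m)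
  repOnBox-final {a} {b} (-1≤a , a≤M+1) (0≤b , b≤M-1) =
    subst (λ x → Rep x b) (b+[a-b]≡a b a) (rep-final 0≤b b≤M-1 -M≤a-b a-b≤M+1)
    where
    b+[a-b]≡a : ∀ b a → b + (a - b) ≡ a
    b+[a-b]≡a = solve-∀
    -1-[M-1]≡-M : ∀ M → -1ℤ + - (M - 1ℤ) ≡ - M
    -1-[M-1]≡-M = solve-∀
    -M≤a-b : - M ≤ a - b
    -M≤a-b = subst (_≤ a - b) (-1-[M-1]≡-M M) (+-mono-≤ -1≤a (neg-mono-≤ b≤M-1))
    a-b≤M+1 : a - b ≤ M + 1ℤ
    a-b≤M+1 = subst (a - b ≤_) (+-identityʳ (M + 1ℤ)) (+-mono-≤ a≤M+1 (neg-mono-≤ 0≤b))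

  repOnBox-step : ∀ {Kᵃ Uᵃ Kᵇ Uᵇ Kᵃ′ Uᵃ′ Kᵇ′ Uᵇ′} →
    Uᵃ ℕ.< Mₙ ℕ.* suc Kᵃ′ → Cₙ ℕ.+ Kᵃ ℕ.≤ Mₙ ℕ.* suc Uᵃ′ →
    Uᵇ ℕ.< (Mₙ ℕ.+ 1) ℕ.* suc Kᵇ′ → Cₙ ℕ.+ Kᵇ ℕ.≤ (Mₙ ℕ.+ 1) ℕ.* suc Uᵇ′ →
    RepOnBox Kᵃ′ Uᵃ′ Kᵇ′ Uᵇ′ → RepOnBox Kᵃ Uᵃ Kᵇ Uᵇ
  repOnBox-step lowerᵃ upperᵃ lowerᵇ upperᵇ rep′ {a} {b} a∈ b∈ =
    rep (rep′ (digitStep-∈ {Mₙ} digit<C a≡ a∈ lowerᵃ upperᵃ)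
              (digitStep-∈ {Mₙ ℕ.+ 1} digit<C b≡ b∈ lowerᵇ upperᵇ))
    where open Step (divisionStep a b)

  T<Mₙ*3 : T ℕ.< Mₙ ℕ.* 3
  T<Mₙ*3 = ≤-by-offset (2 ℕ.* m) (eq m)
    where
    eq : ∀ m → (2 ℕ.+ m) ℕ.* 3 ≡ suc ((2 ℕ.+ m) ℕ.+ 3) ℕ.+ 2 ℕ.* m
    eq = ℕ-Solver.solve-∀

  T<[Mₙ+1]*2 : T ℕ.< (Mₙ ℕ.+ 1) ℕ.* 2
  T<[Mₙ+1]*2 = ≤-by-offset m (eq m)
    where
    eq : ∀ m → ((2 ℕ.+ m) ℕ.+ 1) ℕ.* 2 ≡ suc ((2 ℕ.+ m) ℕ.+ 3) ℕ.+ m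
    eq = ℕ-Solver.solve-∀

  Mₙ+1<Mₙ*2 : Mₙ ℕ.+ 1 ℕ.< Mₙ ℕ.* 2
  Mₙ+1<Mₙ*2 = ≤-by-offset m (eq m)
    where
    eq : ∀ m → (2 ℕ.+ m) ℕ.* 2 ≡ suc ((2 ℕ.+ m) ℕ.+ 1) ℕ.+ m
    eq = ℕ-Solver.solve-∀

  Cₙ+T≤Mₙ*[1+T] : Cₙ ℕ.+ T ℕ.≤ Mₙ ℕ.* suc T
  Cₙ+T≤Mₙ*[1+T] = ≤-by-offset (2 ℕ.* m ℕ.+ 1) (eq m)
    where
    eq : ∀ m → (2 ℕ.+ m) ℕ.* suc ((2 ℕ.+ m) ℕ.+ 3) ≡
               ((2 ℕ.+ m) ℕ.* ((2 ℕ.+ m) ℕ.+ 1) ℕ.+ ((2 ℕ.+ m) ℕ.+ 3)) ℕ.+ (2 ℕ.* m ℕ.+ 1)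
    eq = ℕ-Solver.solve-∀

  Cₙ+T≤[Mₙ+1]*[2+Mₙ] : Cₙ ℕ.+ T ℕ.≤ (Mₙ ℕ.+ 1) ℕ.* suc (Mₙ ℕ.+ 1)
  Cₙ+T≤[Mₙ+1]*[2+Mₙ] = ≤-by-offset (m ℕ.+ 1) (eq m)
    where
    eq : ∀ m → ((2 ℕ.+ m) ℕ.+ 1) ℕ.* suc ((2 ℕ.+ m) ℕ.+ 1) ≡
               ((2 ℕ.+ m) ℕ.* ((2 ℕ.+ m) ℕ.+ 1) ℕ.+ ((2 ℕ.+ m) ℕ.+ 3)) ℕ.+ (m ℕ.+ 1)
    eq = ℕ-Solver.solve-∀

  Cₙ+2≤Mₙ*[2+Mₙ] : Cₙ ℕ.+ 2 ℕ.≤ Mₙ ℕ.* suc (Mₙ ℕ.+ 1)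
  Cₙ+2≤Mₙ*[2+Mₙ] = ≤-by-offset m (eq m)
    where
    eq : ∀ m → (2 ℕ.+ m) ℕ.* suc ((2 ℕ.+ m) ℕ.+ 1) ≡ ((2 ℕ.+ m) ℕ.* ((2 ℕ.+ m) ℕ.+ 1) ℕ.+ 2) ℕ.+ m
    eq = ℕ-Solver.solve-∀

  Cₙ+1≤[Mₙ+1]*[1+Mₙ] : Cₙ ℕ.+ 1 ℕ.≤ (Mₙ ℕ.+ 1) ℕ.* suc Mₙ
  Cₙ+1≤[Mₙ+1]*[1+Mₙ] = ≤-by-offset (m ℕ.+ 2) (eq m)
    where
    eq : ∀ m → ((2 ℕ.+ m) ℕ.+ 1) ℕ.* suc (2 ℕ.+ m) ≡ ((2 ℕ.+ m) ℕ.* ((2 ℕ.+ m) ℕ.+ 1) ℕ.+ 1) ℕ.+ (m ℕ.+ 2)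
    eq = ℕ-Solver.solve-∀

  -- The boxes are the exact one-step images: a runs through [-T,T], [-2,T], [-2,M+1], [-1,M+1]
  -- and b through [-T,T], [-1,M+1], [-1,M], [0,M], [0,M-1].
  repOnBox-near : RepOnBox T T T T
  repOnBox-near =
    repOnBox-step T<Mₙ*3 Cₙ+T≤Mₙ*[1+T] T<[Mₙ+1]*2 Cₙ+T≤[Mₙ+1]*[2+Mₙ]
      (repOnBox-step T<Mₙ*3 Cₙ+2≤Mₙ*[2+Mₙ] (ℕ.m<m*n _ 2 ℕ.≤-refl) Cₙ+1≤[Mₙ+1]*[1+Mₙ]
        (repOnBox-step {Kᵇ′ = 0} Mₙ+1<Mₙ*2 Cₙ+2≤Mₙ*[2+Mₙ] Mₙ<[Mₙ+1]*1 Cₙ+1≤[Mₙ+1]*[1+Mₙ]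
          (repOnBox-step {Kᵇ′ = 0} Mₙ+1<Mₙ*2 (ℕ.≤-trans (ℕ.+-monoʳ-≤ Cₙ (ℕ.n≤1+n 1)) Cₙ+2≤Mₙ*[2+Mₙ])
                         Mₙ<[Mₙ+1]*1 (ℕ.≤-reflexive (trans (ℕ.+-identityʳ Cₙ) (ℕ.*-comm Mₙ (Mₙ ℕ.+ 1))))
            repOnBox-final)))
    where
    Mₙ<[Mₙ+1]*1 : Mₙ ℕ.< (Mₙ ℕ.+ 1) ℕ.* 1
    Mₙ<[Mₙ+1]*1 = ℕ.≤-reflexive (trans (ℕ.+-comm 1 Mₙ) (sym (ℕ.*-identityʳ (Mₙ ℕ.+ 1))))

  ν : ℤ → ℤ → ℕ
  ν a b = ∣ a ∣ ℕ.⊔ ∣ b ∣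

  step-decreases : ∀ {a b} (st : Step a b) → T ℕ.< ν a b → ν (Step.a′ st) (Step.b′ st) ℕ.< ν a b
  step-decreases {a} {b} st T<ν =
    ℕ.⊔-lub (below ∣ a′ ∣ (ℕ.m≤m⊔n ∣ a ∣ ∣ b ∣)
                   (quotient-shrinks {suc m} Cₙ≤[1+m]*[1+T] (digitStep-abs< {P} {x′ = a′} digit<C a≡)))
            (below ∣ b′ ∣ (ℕ.m≤n⊔m ∣ a ∣ ∣ b ∣)
                   (quotient-shrinks {suc (m ℕ.+ 1)} Cₙ≤[2+m]*[1+T] (digitStep-abs< {Q} {x′ = b′} digit<C b≡)))
    where
    open Step st
    Cₙ≤[1+m]*[1+T] : Cₙ ℕ.≤ suc m ℕ.* suc T
    Cₙ≤[1+m]*[1+T] = ≤-by-offset (2 ℕ.* m) (eq m)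
      where
      eq : ∀ m → suc m ℕ.* suc ((2 ℕ.+ m) ℕ.+ 3) ≡ (2 ℕ.+ m) ℕ.* ((2 ℕ.+ m) ℕ.+ 1) ℕ.+ 2 ℕ.* m
      eq = ℕ-Solver.solve-∀
    Cₙ≤[2+m]*[1+T] : Cₙ ℕ.≤ suc (m ℕ.+ 1) ℕ.* suc T
    Cₙ≤[2+m]*[1+T] = ℕ.≤-trans Cₙ≤[1+m]*[1+T] (ℕ.*-monoˡ-≤ (suc T) (s≤s (ℕ.m≤m+n m 1)))
    below : ∀ {A} A′ → A ℕ.≤ ν a b → A′ ℕ.≤ T ⊎ A′ ℕ.< A → A′ ℕ.< ν a b
    below _ _   (inj₁ A′≤T) = ℕ.≤-<-trans A′≤T T<ν
    below _ A≤ν (inj₂ A′<A) = ℕ.<-≤-trans A′<A A≤ν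

  rep-below : ∀ n {a b} → ν a b ℕ.< n → Rep a b
  rep-below (suc n) {a} {b} ν<1+n with ν a b ℕ.≤? T
  ... | yes ν≤T = repOnBox-near (∣x∣≤K⇒x∈[-K,K] (ℕ.≤-trans (ℕ.m≤m⊔n ∣ a ∣ ∣ b ∣) ν≤T))
                                (∣x∣≤K⇒x∈[-K,K] (ℕ.≤-trans (ℕ.m≤n⊔m ∣ a ∣ ∣ b ∣) ν≤T))
  ... | no  ν≰T = Step.rep st (rep-below n (ℕ.<-≤-trans (step-decreases st (ℕ.≰⇒> ν≰T)) (s≤s⁻¹ ν<1+n)))
    where
    st : Step a b
    st = divisionStep a b

  adjacentBases-expansion : ∀ a b → Rep a b
  adjacentBases-expansion a b = rep-below (suc (ν a b)) ℕ.≤-refl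

negativeBase-fep : (N : Fin 1 → ℤ) → N zero ≤ -[1+ 1 ] → FiniteExpansionProperty N
negativeBase-fep N N₀≤-2 with ≤-2⇒≡-[2+n] N₀≤-2
... | m , N₀≡ = fep-single N N₀≡ refl (NegativeBase.negativeBase-expansion m)

adjacentBases-fep : (N : Fin 2 → ℤ) → (∀ i → N i ≤ -[1+ 1 ]) → ∣ N zero - N (suc zero) ∣ ≡ 1 →
                    FiniteExpansionProperty N
adjacentBases-fep N N≤-2 N₀N₁-adjacent with ∣i-j∣≡1⇒adjacent N₀N₁-adjacent
... | inj₁ N₁≡N₀-1 with ≤-2⇒≡-[2+n] (N≤-2 zero)
...   | m , N₀≡P = fep-pair N N₀≡P (trans N₁≡N₀-1 (P-1≡Q N₀≡P)) refl adjacentBases-expansion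
  where open AdjacentBases m
adjacentBases-fep N N≤-2 N₀N₁-adjacent | inj₂ N₀≡N₁-1 with ≤-2⇒≡-[2+n] (N≤-2 (suc zero))
...   | m , N₁≡P = fep-pair N (trans N₀≡N₁-1 (P-1≡Q N₁≡P)) N₁≡P (ℕ.*-comm ∣ Q ∣ ∣ P ∣)
                     (λ a b → jointExpansion-swap (adjacentBases-expansion b a))
  where open AdjacentBases m

Conditions : (k : ℕ) → (Fin k → ℤ) → Set
Conditions k N =
  ((i : Fin k) → N i ≤ -[1+ 1 ]) ×
  (k ≡ 1 ⊎ (k ≡ 2 × ((i j : Fin k) → i ≢ j → ∣ N i - N j ∣ ≡ 1)))

necessity : ∀ k → 1 ℕ.≤ k → (N : Fin k → ℤ) → FiniteExpansionProperty N → Conditions k N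
necessity 1 _ N fep = single-fep⇒≤-2 N fep , inj₁ refl
necessity 2 _ N fep = pair-fep⇒≤-2 N fep , inj₂ (refl , λ _ _ → fep⇒adjacent N fep)
necessity (suc (suc (suc k))) _ N fep =
  ⊥-elim (no-three-adjacent (N zero) (N (suc zero)) (N (suc (suc zero)))
            (fep⇒adjacent N fep (λ ())) (fep⇒adjacent N fep (λ ())) (fep⇒adjacent N fep (λ ())))

sufficiency : ∀ k (N : Fin k → ℤ) → Conditions k N → FiniteExpansionProperty N
sufficiency .1 N (N≤-2 , inj₁ refl)            = negativeBase-fep N (N≤-2 zero)
sufficiency .2 N (N≤-2 , inj₂ (refl , adjacent)) = adjacentBases-fep N N≤-2 (adjacent zero (suc zero) (λ ()))

corollary4p5 : (k : ℕ) → 1 ℕ.≤ k → (N : Fin k → ℤ) →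
    ((i : Fin k) → N i ≢ ℤ.0ℤ) →
    ((i j : Fin k) → i ≢ j → Coprime ℤ.∣ N i ∣ ℤ.∣ N j ∣) →
    FiniteExpansionProperty N ⇔
      (((i : Fin k) → N i ≤ -[1+ 1 ]) ×
       (k ≡ 1 ⊎ (k ≡ 2 × ((i j : Fin k) → i ≢ j → ℤ.∣ N i - N j ∣ ≡ 1))))
corollary4p5 k 1≤k N _ _ = mk⇔ (necessity k 1≤k N) (sufficiency k N)
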